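{- For all integers $n \ge 1$ and $d \ge 1$, $\lambda(n) \le \lfloor n/d \rfloor + d$.
   Context: All posets are finite. A linear extension of a poset $P=(X,\preceq)$ is a total ordering of $X$ compatible with $\preceq$; $e(P)$ denotes the number of linear extensions of $P$. The size $|P|$ of $P$ is $|X|$. For an integer $n\ge 1$, $\lambda(n)=\min\{|P| : e(P)=n\}$ (the empty poset has exactly one linear extension, so $\lambda(1)=0$). -}

module Defs where

open import Data.Nat using (ℕ; _≤_)
open import Data.Fin using (Fin)
import Data.Fin as F
open import Data.Vec using (Vec; lookup)
open import Data.List using (List; length)
open import Data.List.Relation.Unary.Unique.Propositional using (Unique)
open import Data.List.Membership.Propositional using (_∈_)
open import Data.Product using (_×_; Σ; ∃)
open import Function.Bundles using (_⇔_)
open import Relation.Binary.PropositionalEquality using (_≡_)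
open import Relation.Binary.Structures using (IsPartialOrder)

record FinPoset : Set₁ where
  field
    size      : ℕ
    _≼_       : Fin size → Fin size → Set
    isPartial : IsPartialOrder _≡_ _≼_

open FinPoset public

-- A linear extension of P, written as the listing v of the elements of P
-- in increasing order: v is a bijection Fin size → Fin size (injective
-- on a finite set of equal size), and x ≼ y implies x is listed no later
-- than y.
IsLinearExtension : (P : FinPoset) → Vec (Fin (size P)) (size P) → Set
IsLinearExtension P v =
  (∀ i j → lookup v i ≡ lookup v j → i ≡ j) ×
  (∀ i j → _≼_ P (lookup v i) (lookup v j) → i F.≤ j)

NumLinExt : FinPoset → ℕ → Set
NumLinExt P n =
  Σ (List (Vec (Fin (size P)) (size P))) λ L →
    Unique L × length L ≡ n × (∀ v → (v ∈ L) ⇔ IsLinearExtension P v)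

-- λ(n) ≤ k, i.e. min{ |P| : e(P) = n } ≤ k, which holds iff some poset
-- P with e(P) = n has |P| ≤ k.
λ≤ : ℕ → ℕ → Set₁
λ≤ n k = ∃ λ (P : FinPoset) → NumLinExt P n × size P ≤ k

module Submission where

-- For A, p, q ≥ 0 let G(A,p,q)
-- be a chain of c = A + p + q elements together with an element z below the
-- top A chain elements and an element w above the bottom q chain elements.
-- A linear extension is determined by the gaps of the chain receiving z and
-- w, and counting admissible pairs of gaps gives
--     e(G(A,p,q)) = (p+q+1)(A+p+1) + (p+1),    |G(A,p,q)| = A + p + q + 2.
-- Formally the count is obtained by peeling off minimal elements: a linear
-- extension is a listing whose head is minimal among the elements not yet
-- listed, and the sets of not-yet-listed elements of G(A,p,q) form a small
-- family of states whose listings are enumerated by recursion.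
--
-- Writing n = Qd + R with 0 ≤ R < d, suitable A, p, q
-- realise n with at most Q + d elements when d ≤ Q + 1, and for d > Q + 1
-- passing to the divisor d - 1 does not increase ⌊n/d⌋ + d.  The case
-- n = 1 is the empty poset.

open import Defs
open import Data.Bool using (Bool; true; false; T)
open import Data.Bool.Properties using (T-≡)
open import Data.Empty using (⊥; ⊥-elim)
open import Data.Unit using (⊤; tt)
open import Data.Fin using (Fin; zero; suc; toℕ; fromℕ<; punchOut)
import Data.Fin as Fin
import Data.Fin.Properties as FinP
open import Data.List using (List; []; _∷_; length; map; _++_)
open import Data.List.Properties using (length-map; length-++; map-∘; map-id-local; ∷-injectiveʳ)
import Data.List.Relation.Unary.All as All
open import Data.List.Relation.Unary.AllPairs using ([]; _∷_)
open import Data.List.Relation.Unary.Any using (here; there)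
open import Data.List.Relation.Unary.Unique.Propositional using (Unique)
import Data.List.Relation.Unary.Unique.Propositional.Properties as Unique
open import Data.List.Membership.Propositional using (_∈_)
open import Data.List.Membership.Propositional.Properties
  using (∈-map⁺; ∈-map⁻; ∈-++⁺ˡ; ∈-++⁺ʳ; ∈-++⁻)
open import Data.Nat
  using (ℕ; zero; suc; _+_; _*_; _≤_; _<_; z≤n; s≤s; s≤s⁻¹; z<s; _≤?_; _<?_; NonZero)
open import Data.Nat.Properties
open import Data.Nat.DivMod using (_/_; _%_; m≡m%n+[m/n]*n; m%n<n)
open import Data.Nat.Tactic.RingSolver using (solve-∀)
open import Data.Product using (Σ; _×_; _,_; proj₁; proj₂)
open import Data.Sum using (_⊎_; inj₁; inj₂)
open import Data.Vec using (Vec; []; _∷_; lookup; toList; fromList)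
open import Data.Vec.Properties using (toList∘fromList)
open import Function.Bundles using (_⇔_; mk⇔; Equivalence)
open import Function.Construct.Symmetry using (⇔-sym)
open import Relation.Binary.Definitions using (DecidableEquality; tri<; tri≈; tri>)
open import Relation.Binary.PropositionalEquality
  using (_≡_; _≢_; refl; sym; trans; cong; cong₂; subst; subst₂; isEquivalence; module ≡-Reasoning)
open import Relation.Binary.PropositionalEquality.Properties using (isPartialOrder)
open import Relation.Nullary using (¬_; yes; no)

open Equivalence using (to; from)

module _ {Y : Set} where

  Enumerates : (Y → Set) → ℕ → Set
  Enumerates Q n = Σ (List Y) λ L → Unique L × length L ≡ n × (∀ y → (y ∈ L) ⇔ Q y)

  enum-cong : ∀ {Q Q' : Y → Set} {n} → (∀ y → Q y ⇔ Q' y) →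
              Enumerates Q n → Enumerates Q' n
  enum-cong Q⇔Q' (L , unique , len , mem) =
    L , unique , len , λ y → mk⇔ (λ y∈L → to (Q⇔Q' y) (to (mem y) y∈L))
                                 (λ q → from (mem y) (from (Q⇔Q' y) q))

  enum-none : ∀ {Q : Y → Set} → (∀ y → ¬ Q y) → Enumerates Q 0
  enum-none none = [] , [] , refl , λ y → mk⇔ (λ ()) (λ q → ⊥-elim (none y q))

  enum-one : (y₀ : Y) → Enumerates (_≡ y₀) 1
  enum-one y₀ = y₀ ∷ [] , All.[] ∷ [] , refl ,
                λ y → mk⇔ (λ { (here eq) → eq ; (there ()) }) here

  enum-⊎ : ∀ {Q₁ Q₂ : Y → Set} {n₁ n₂} → (∀ y → Q₁ y → ¬ Q₂ y) →
           Enumerates Q₁ n₁ → Enumerates Q₂ n₂ →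
           Enumerates (λ y → Q₁ y ⊎ Q₂ y) (n₁ + n₂)
  enum-⊎ {Q₁} {Q₂} disjoint (L₁ , u₁ , len₁ , mem₁) (L₂ , u₂ , len₂ , mem₂) =
    L₁ ++ L₂ ,
    Unique.++⁺ u₁ u₂ (λ (y∈L₁ , y∈L₂) → disjoint _ (to (mem₁ _) y∈L₁) (to (mem₂ _) y∈L₂)) ,
    trans (length-++ L₁) (cong₂ _+_ len₁ len₂) ,
    λ y → mk⇔ (into y) (out y)
    where
    into : ∀ y → y ∈ L₁ ++ L₂ → Q₁ y ⊎ Q₂ y
    into y y∈L with ∈-++⁻ L₁ y∈L
    ... | inj₁ y∈L₁ = inj₁ (to (mem₁ y) y∈L₁)
    ... | inj₂ y∈L₂ = inj₂ (to (mem₂ y) y∈L₂)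
    out : ∀ y → Q₁ y ⊎ Q₂ y → y ∈ L₁ ++ L₂
    out y (inj₁ q) = ∈-++⁺ˡ (from (mem₁ y) q)
    out y (inj₂ q) = ∈-++⁺ʳ L₁ (from (mem₂ y) q)

module _ {X : Set} where

  StartsWith : X → (List X → Set) → List X → Set
  StartsWith x Q l = Σ (List X) λ u → l ≡ x ∷ u × Q u

  startsWith-head : ∀ {x y Q Q' l} → StartsWith x Q l → StartsWith y Q' l → x ≡ y
  startsWith-head (_ , refl , _) (_ , refl , _) = refl

  enum-∷ : ∀ {Q n} (x : X) → Enumerates Q n → Enumerates (StartsWith x Q) n
  enum-∷ {Q} x (L , unique , len , mem) =
    map (x ∷_) L , Unique.map⁺ ∷-injectiveʳ unique , trans (length-map _ L) len ,
    λ l → mk⇔ (into l) (out l)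
    where
    into : ∀ l → l ∈ map (x ∷_) L → StartsWith x Q l
    into l l∈ with ∈-map⁻ (x ∷_) l∈
    ... | u , u∈L , eq = u , eq , to (mem u) u∈L
    out : ∀ l → StartsWith x Q l → l ∈ map (x ∷_) L
    out l (u , refl , q) = ∈-map⁺ (x ∷_) (from (mem u) q)

module Listings {X : Set} (_⊑_ : X → X → Set) where

  _∖_ : (X → Set) → X → X → Set
  (S ∖ x) y = S y × y ≢ x

  Listing : (X → Set) → List X → Set
  Listing S []      = ∀ y → ¬ S y
  Listing S (x ∷ l) = S x × (∀ y → S y → y ⊑ x → y ≡ x) × Listing (S ∖ x) l

  listing-cong : ∀ {S S' : X → Set} → (∀ y → S y ⇔ S' y) → ∀ l → Listing S l → Listing S' l
  listing-cong S⇔S' [] empty y s' = empty y (from (S⇔S' y) s')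
  listing-cong S⇔S' (x ∷ l) (sx , minimal , rest) =
    to (S⇔S' x) sx , (λ y s' → minimal y (from (S⇔S' y) s')) ,
    listing-cong (λ y → mk⇔ (λ (s , y≢x) → to (S⇔S' y) s , y≢x)
                            (λ (s' , y≢x) → from (S⇔S' y) s' , y≢x)) l rest

  Ordered : ∀ {k} → Vec X k → Set
  Ordered v = (∀ i j → lookup v i ≡ lookup v j → i ≡ j) ×
              (∀ i j → lookup v i ⊑ lookup v j → i Fin.≤ j)

  listing⇒ordered : ∀ {k} S (v : Vec X k) → Listing S (toList v) →
                    Ordered v × (∀ i → S (lookup v i))
  listing⇒ordered S [] _ = ((λ ()) , (λ ())) , (λ ())
  listing⇒ordered S (x ∷ v) (sx , minimal , rest)
    with listing⇒ordered (S ∖ x) v rest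
  ... | (distinct , monotone) , inS∖x = (distinct′ , monotone′) , inS
    where
    distinct′ : ∀ i j → lookup (x ∷ v) i ≡ lookup (x ∷ v) j → i ≡ j
    distinct′ zero    zero    _  = refl
    distinct′ zero    (suc j) eq = ⊥-elim (proj₂ (inS∖x j) (sym eq))
    distinct′ (suc i) zero    eq = ⊥-elim (proj₂ (inS∖x i) eq)
    distinct′ (suc i) (suc j) eq = cong suc (distinct i j eq)
    monotone′ : ∀ i j → lookup (x ∷ v) i ⊑ lookup (x ∷ v) j → i Fin.≤ j
    monotone′ zero    j       _ = z≤n
    monotone′ (suc i) zero    r = ⊥-elim (proj₂ (inS∖x i) (minimal _ (proj₁ (inS∖x i)) r))
    monotone′ (suc i) (suc j) r = s≤s (monotone i j r)
    inS : ∀ i → S (lookup (x ∷ v) i)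
    inS zero    = sx
    inS (suc i) = proj₁ (inS∖x i)

  listing-covers : DecidableEquality X → ∀ {k} S (v : Vec X k) → Listing S (toList v) →
                   ∀ y → S y → Σ (Fin k) λ i → lookup v i ≡ y
  listing-covers _≟_ S [] empty y sy = ⊥-elim (empty y sy)
  listing-covers _≟_ S (x ∷ v) (_ , _ , rest) y sy with y ≟ x
  ... | yes refl = zero , refl
  ... | no y≢x with listing-covers _≟_ (S ∖ x) v rest y (sy , y≢x)
  ...   | i , eq = suc i , eq

  ordered⇒listing : ∀ {k} S (v : Vec X k) → Ordered v → (∀ i → S (lookup v i)) →
                    (∀ y → S y → Σ (Fin k) λ i → lookup v i ≡ y) → Listing S (toList v)
  ordered⇒listing S [] _ _ covers y sy with covers y sy
  ... | () , _
  ordered⇒listing {suc k} S (x ∷ v) (distinct , monotone) inS covers =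
    inS zero , minimal , ordered⇒listing (S ∖ x) v (distinct′ , monotone′) inS∖x covers∖x
    where
    minimal : ∀ y → S y → y ⊑ x → y ≡ x
    minimal y sy y⊑x with covers y sy
    ... | zero  , eq   = sym eq
    ... | suc i , refl with monotone (suc i) zero y⊑x
    ...   | ()
    distinct′ : ∀ i j → lookup v i ≡ lookup v j → i ≡ j
    distinct′ i j eq = FinP.suc-injective (distinct (suc i) (suc j) eq)
    monotone′ : ∀ i j → lookup v i ⊑ lookup v j → i Fin.≤ j
    monotone′ i j r = s≤s⁻¹ (monotone (suc i) (suc j) r)
    inS∖x : ∀ i → (S ∖ x) (lookup v i)
    inS∖x i = inS (suc i) , λ eq → FinP.0≢1+n (sym (distinct (suc i) zero eq))
    covers∖x : ∀ y → (S ∖ x) y → Σ (Fin k) λ i → lookup v i ≡ y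
    covers∖x y (sy , y≢x) with covers y sy
    ... | zero  , eq = ⊥-elim (y≢x (sym eq))
    ... | suc i , eq = i , eq

-- An injective map Fin s → Fin s is surjective: a missed value y would let
-- `punchOut` compress it injectively into Fin (s - 1).
fin-injective⇒surjective : ∀ {s} (f : Fin s → Fin s) → (∀ {i j} → f i ≡ f j → i ≡ j) →
                           ∀ y → Σ (Fin s) λ i → f i ≡ y
fin-injective⇒surjective {suc s} f injective y with FinP.any? (λ i → f i FinP.≟ y)
... | yes hit  = hit
... | no  miss = ⊥-elim (<-irrefl refl (FinP.injective⇒≤ compress-injective))
  where
  avoids : ∀ i → y ≢ f i
  avoids i eq = miss (i , sym eq)
  compress : Fin (suc s) → Fin s
  compress i = punchOut (avoids i)
  compress-injective : ∀ {i j} → compress i ≡ compress j → i ≡ j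
  compress-injective eq = injective (FinP.punchOut-injective (avoids _) (avoids _) eq)

padTo : ∀ {X : Set} → X → ∀ k → List X → Vec X k
padTo d zero    _       = []
padTo d (suc k) []      = d ∷ padTo d k []
padTo d (suc k) (x ∷ l) = x ∷ padTo d k l

toList-padTo : ∀ {X : Set} (d : X) k l → length l ≡ k → toList (padTo d k l) ≡ l
toList-padTo d zero    []      _   = refl
toList-padTo d (suc k) (x ∷ l) len = cong (x ∷_) (toList-padTo d k l (suc-injective len))

padTo-toList : ∀ {X : Set} (d : X) k (v : Vec X k) → padTo d k (toList v) ≡ v
padTo-toList d zero    []      = refl
padTo-toList d (suc k) (x ∷ v) = cong (x ∷_) (padTo-toList d k v)

module _ (P : FinPoset) where
  open Listings (_≼_ P)

  Whole : Fin (size P) → Set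
  Whole _ = ⊤

  -- A listing of all of P has length |P|: its positions inject into P and,
  -- since it covers P, P injects into its positions.
  listing-length : ∀ l → Listing Whole l → length l ≡ size P
  listing-length l listing =
    ≤-antisym (FinP.injective⇒≤ (λ {i} {j} → distinct i j))
              (FinP.injective⇒≤ position-injective)
    where
    v : Vec (Fin (size P)) (length l)
    v = fromList l
    listing′ : Listing Whole (toList v)
    listing′ = subst (Listing Whole) (sym (toList∘fromList l)) listing
    distinct : ∀ i j → lookup v i ≡ lookup v j → i ≡ j
    distinct = proj₁ (proj₁ (listing⇒ordered Whole v listing′))
    covered : ∀ y → Σ (Fin (length l)) λ i → lookup v i ≡ y
    covered y = listing-covers FinP._≟_ Whole v listing′ y tt
    position : Fin (size P) → Fin (length l)
    position y = proj₁ (covered y)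
    position-injective : ∀ {x y} → position x ≡ position y → x ≡ y
    position-injective {x} {y} eq =
      trans (sym (proj₂ (covered x))) (trans (cong (lookup v) eq) (proj₂ (covered y)))

  -- e(P) = n as soon as the listings of all of P are enumerated with count
  -- n.  (An element x₀ of P is needed only to turn lists into vectors.)
  numLinExt-from-listings : ∀ {n} → Fin (size P) → Enumerates (Listing Whole) n → NumLinExt P n
  numLinExt-from-listings x₀ (L , unique , len , mem) =
    map toVec L , unique-vectors , trans (length-map toVec L) len ,
    λ v → mk⇔ (listed⇒linExt v) (linExt⇒listed v)
    where
    toVec : List (Fin (size P)) → Vec (Fin (size P)) (size P)
    toVec = padTo x₀ (size P)
    toList-toVec : ∀ {l} → l ∈ L → toList (toVec l) ≡ l
    toList-toVec {l} l∈L = toList-padTo x₀ (size P) l (listing-length l (to (mem l) l∈L))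
    unique-vectors : Unique (map toVec L)
    unique-vectors = Unique.map⁻ {f = toList} (subst Unique (sym recovered) unique)
      where
      recovered : map toList (map toVec L) ≡ L
      recovered = trans (sym (map-∘ L)) (map-id-local (All.tabulate toList-toVec))
    listed⇒linExt : ∀ v → v ∈ map toVec L → IsLinearExtension P v
    listed⇒linExt v v∈ with ∈-map⁻ toVec v∈
    ... | l , l∈L , refl = proj₁ (listing⇒ordered Whole (toVec l)
            (subst (Listing Whole) (sym (toList-toVec l∈L)) (to (mem l) l∈L)))
    linExt⇒listed : ∀ v → IsLinearExtension P v → v ∈ map toVec L
    linExt⇒listed v ordered@(distinct , _) =
      subst (_∈ map toVec L) (padTo-toList x₀ (size P) v) (∈-map⁺ toVec (from (mem (toList v))
        (ordered⇒listing Whole v ordered (λ _ → tt)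
          (λ y _ → fin-injective⇒surjective (lookup v) (λ {i} {j} → distinct i j) y))))

-- The poset G(A,p,q) on 2 + c elements, c = A + p + q: the bottom pendant
-- z, the top pendant w and a chain e₀ ⊒ e₁ ⊒ ⋯ ⊒ e_{c-1}, where z lies below
-- e₀ … e_{A-1} and w above e_B … e_{c-1} (B = A + p).
module Gadget (A p q : ℕ) where

  c B : ℕ
  c = A + p + q
  B = A + p

  El : Set
  El = Fin (2 + c)

  pattern z   = zero
  pattern w   = suc zero
  pattern e k = suc (suc k)

  data _⊑_ : El → El → Set where
    ⊑-refl : ∀ {x} → x ⊑ x
    e⊑e    : ∀ {j k} → toℕ k ≤ toℕ j → e j ⊑ e k
    z⊑e    : ∀ {k} → toℕ k < A → z ⊑ e k
    e⊑w    : ∀ {k} → B ≤ toℕ k → e k ⊑ w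

  -- z ⊑ e ⊑ w never happens since A ≤ B: z and w stay incomparable.
  ⊑-trans : ∀ {x y u} → x ⊑ y → y ⊑ u → x ⊑ u
  ⊑-trans ⊑-refl    y⊑u       = y⊑u
  ⊑-trans (e⊑e k≤j) ⊑-refl    = e⊑e k≤j
  ⊑-trans (e⊑e k≤j) (e⊑e l≤k) = e⊑e (≤-trans l≤k k≤j)
  ⊑-trans (e⊑e k≤j) (e⊑w B≤k) = e⊑w (≤-trans B≤k k≤j)
  ⊑-trans (z⊑e k<A) ⊑-refl    = z⊑e k<A
  ⊑-trans (z⊑e k<A) (e⊑e l≤k) = z⊑e (≤-<-trans l≤k k<A)
  ⊑-trans (z⊑e k<A) (e⊑w B≤k) = ⊥-elim (<-irrefl refl (<-≤-trans k<A (≤-trans (m≤m+n A p) B≤k)))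
  ⊑-trans (e⊑w B≤k) ⊑-refl    = e⊑w B≤k

  ⊑-antisym : ∀ {x y} → x ⊑ y → y ⊑ x → x ≡ y
  ⊑-antisym ⊑-refl    _         = refl
  ⊑-antisym (e⊑e _)   ⊑-refl    = refl
  ⊑-antisym (e⊑e k≤j) (e⊑e j≤k) = cong e (FinP.toℕ-injective (≤-antisym j≤k k≤j))

  poset : FinPoset
  poset = record
    { size      = 2 + c
    ; _≼_       = _⊑_
    ; isPartial = record
      { isPreorder = record
        { isEquivalence = isEquivalence
        ; reflexive     = λ { refl → ⊑-refl }
        ; trans         = ⊑-trans }
      ; antisym = ⊑-antisym } }

  open Listings _⊑_

  -- The states of the peeling process: z and w if the flags say so, and the
  -- top m chain elements e₀ … e_{m-1}.  Minimal elements are always peeled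
  -- from the bottom of the chain, so every remaining set has this form.
  Alive : Bool → Bool → ℕ → El → Set
  Alive bz bw m z     = T bz
  Alive bz bw m w     = T bw
  Alive bz bw m (e k) = toℕ k < m

  remove-z : ∀ bw m y → (Alive true bw m ∖ z) y ⇔ Alive false bw m y
  remove-z bw m z     = mk⇔ (λ (_ , z≢z) → z≢z refl) λ ()
  remove-z bw m w     = mk⇔ proj₁ (_, λ ())
  remove-z bw m (e k) = mk⇔ proj₁ (_, λ ())

  remove-w : ∀ bz m y → (Alive bz true m ∖ w) y ⇔ Alive bz false m y
  remove-w bz m z     = mk⇔ proj₁ (_, λ ())
  remove-w bz m w     = mk⇔ (λ (_ , w≢w) → w≢w refl) λ ()
  remove-w bz m (e j) = mk⇔ proj₁ (_, λ ())

  remove-e : ∀ bz bw m (k : Fin c) → toℕ k ≡ m →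
             ∀ y → (Alive bz bw (suc m) ∖ e k) y ⇔ Alive bz bw m y
  remove-e bz bw m k k≡m z     = mk⇔ proj₁ (_, λ ())
  remove-e bz bw m k k≡m w     = mk⇔ proj₁ (_, λ ())
  remove-e bz bw m k k≡m (e j) = mk⇔ into (λ j<m → m≤n⇒m≤1+n j<m , out j<m)
    where
    into : (Alive bz bw (suc m) ∖ e k) (e j) → toℕ j < m
    into (j<1+m , ej≢ek) with m≤n⇒m<n∨m≡n (s≤s⁻¹ j<1+m)
    ... | inj₁ j<m = j<m
    ... | inj₂ j≡m = ⊥-elim (ej≢ek (cong e (FinP.toℕ-injective (trans j≡m (sym k≡m)))))
    out : toℕ j < m → e j ≢ e k
    out j<m refl = <-irrefl k≡m j<m

  -- The four ways a listing of `Alive bz bw m` can begin: it is empty, or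
  -- its head is one of the possible minimal elements z, w (minimal once no
  -- e_k with k ≥ B is alive) or e_{m-1} (minimal unless z is alive and
  -- m - 1 < A).
  Done ZFirst WFirst EFirst Start : Bool → Bool → ℕ → List El → Set
  Done   bz bw m l = bz ≡ false × bw ≡ false × m ≡ 0 × l ≡ []
  ZFirst bz bw m l = bz ≡ true × StartsWith z (Listing (Alive false bw m)) l
  WFirst bz bw m l = bw ≡ true × m ≤ B × StartsWith w (Listing (Alive bz false m)) l
  EFirst bz bw m l = Σ ℕ λ m′ → m ≡ suc m′ × (bz ≡ true → A ≤ m′) ×
                     Σ (Fin c) λ k → toℕ k ≡ m′ × StartsWith (e k) (Listing (Alive bz bw m′)) l
  Start  bz bw m l = Done bz bw m l ⊎ ZFirst bz bw m l ⊎ WFirst bz bw m l ⊎ EFirst bz bw m l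

  chainElement : ∀ {m} → m < c → Σ (Fin c) λ k → toℕ k ≡ m
  chainElement m<c = fromℕ< m<c , FinP.toℕ-fromℕ< m<c

  -- Every listing begins in one of the four ways: a head other than these
  -- would have an alive element below it.
  listing⇒start : ∀ bz bw m → m ≤ c → ∀ l → Listing (Alive bz bw m) l → Start bz bw m l
  listing⇒start true  bw    m       _   []      empty = ⊥-elim (empty z tt)
  listing⇒start false true  m       _   []      empty = ⊥-elim (empty w tt)
  listing⇒start false false zero    _   []      _     = inj₁ (refl , refl , refl , refl)
  listing⇒start false false (suc m) m<c []      empty with chainElement m<c
  ... | k , k≡m = ⊥-elim (empty (e k) (subst (_< suc m) (sym k≡m) (n<1+n m)))
  listing⇒start true  bw    m       _   (z ∷ u) (_ , _ , rest) =
    inj₂ (inj₁ (refl , u , refl , listing-cong (remove-z bw m) u rest))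
  listing⇒start bz    true  m       m≤c (w ∷ u) (_ , minimal , rest) with m ≤? B
  ... | yes m≤B = inj₂ (inj₂ (inj₁ (refl , m≤B , u , refl , listing-cong (remove-w bz m) u rest)))
  ... | no  m≰B with chainElement (<-≤-trans (≰⇒> m≰B) m≤c)
  ...   | k , k≡B with minimal (e k) (subst (_< m) (sym k≡B) (≰⇒> m≰B)) (e⊑w (≤-reflexive (sym k≡B)))
  ...     | ()
  listing⇒start false false zero    _   (z ∷ u)   (() , _)
  listing⇒start false false zero    _   (w ∷ u)   (() , _)
  listing⇒start false false zero    _   (e k ∷ u) (() , _)
  listing⇒start bz    bw    (suc m) m<c (e k ∷ u) (k<1+m , minimal , rest) =
    inj₂ (inj₂ (inj₂ (m , refl , A≤m , k , k≡m , u , refl ,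
      listing-cong (remove-e bz bw m k k≡m) u rest)))
    where
    -- e_k is minimal, so no chain element below it is alive: k = m.
    k≡m : toℕ k ≡ m
    k≡m with m≤n⇒m<n∨m≡n (s≤s⁻¹ k<1+m)
    ... | inj₂ k≡m = k≡m
    ... | inj₁ k<m with chainElement m<c
    ...   | j , j≡m with minimal (e j) (subst (_< suc m) (sym j≡m) (n<1+n m))
                                       (e⊑e (subst (toℕ k ≤_) (sym j≡m) (<⇒≤ k<m)))
    ...     | ej≡ek = ⊥-elim (<-irrefl (trans (cong index (sym ej≡ek)) j≡m) k<m)
      where
      index : El → ℕ
      index (e i) = toℕ i
      index _     = 0
    -- e_m is minimal, so z is not below it.
    A≤m : bz ≡ true → A ≤ m
    A≤m refl with A ≤? m
    ... | yes A≤m = A≤m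
    ... | no  A≰m with minimal z tt (z⊑e (subst (_< A) (sym k≡m) (≰⇒> A≰m)))
    ...   | ()

  start⇒listing : ∀ bz bw m l → Start bz bw m l → Listing (Alive bz bw m) l
  start⇒listing .false .false .zero .[] (inj₁ (refl , refl , refl , refl)) = λ { z () ; w () ; (e _) () }
  start⇒listing .true bw m l (inj₂ (inj₁ (refl , u , refl , rest))) =
    tt , minimal , listing-cong (λ y → ⇔-sym (remove-z bw m y)) u rest
    where
    minimal : ∀ y → Alive true bw m y → y ⊑ z → y ≡ z
    minimal y _ ⊑-refl = refl
  start⇒listing bz .true m l (inj₂ (inj₂ (inj₁ (refl , m≤B , u , refl , rest)))) =
    tt , minimal , listing-cong (λ y → ⇔-sym (remove-w bz m y)) u rest
    where
    minimal : ∀ y → Alive bz true m y → y ⊑ w → y ≡ w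
    minimal y     _   ⊑-refl    = refl
    minimal (e k) k<m (e⊑w B≤k) = ⊥-elim (<-irrefl refl (<-≤-trans k<m (≤-trans m≤B B≤k)))
  start⇒listing bz bw .(suc m) l (inj₂ (inj₂ (inj₂ (m , refl , A≤m , k , k≡m , u , refl , rest)))) =
    subst (_< suc m) (sym k≡m) (n<1+n m) , minimal ,
    listing-cong (λ y → ⇔-sym (remove-e bz bw m k k≡m y)) u rest
    where
    minimal : ∀ y → Alive bz bw (suc m) y → y ⊑ e k → y ≡ e k
    minimal y     _     ⊑-refl    = refl
    minimal (e j) j<1+m (e⊑e k≤j) =
      cong e (FinP.toℕ-injective (≤-antisym (≤-trans (s≤s⁻¹ j<1+m) (≤-reflexive (sym k≡m))) k≤j))
    minimal z     z-alive (z⊑e k<A) = ⊥-elim (<-irrefl refl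
      (<-≤-trans k<A (≤-trans (A≤m (to T-≡ z-alive)) (≤-reflexive (sym k≡m)))))

  enum-alive : ∀ {bz bw m n₁ n₂ n₃ n₄} → m ≤ c →
               Enumerates (Done bz bw m) n₁ → Enumerates (ZFirst bz bw m) n₂ →
               Enumerates (WFirst bz bw m) n₃ → Enumerates (EFirst bz bw m) n₄ →
               Enumerates (Listing (Alive bz bw m)) (n₁ + (n₂ + (n₃ + n₄)))
  enum-alive {bz} {bw} {m} m≤c done zFirst wFirst eFirst =
    enum-cong (λ l → mk⇔ (start⇒listing bz bw m l) (listing⇒start bz bw m m≤c l))
      (enum-⊎ done-excl done (enum-⊎ z-excl zFirst (enum-⊎ w-excl wFirst eFirst)))
    where
    w-excl : ∀ l → WFirst bz bw m l → ¬ EFirst bz bw m l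
    w-excl l (_ , _ , sw) (_ , _ , _ , _ , _ , se) with startsWith-head sw se
    ... | ()
    z-excl : ∀ l → ZFirst bz bw m l → ¬ (WFirst bz bw m l ⊎ EFirst bz bw m l)
    z-excl l (_ , sz) (inj₁ (_ , _ , sw)) with startsWith-head sz sw
    ... | ()
    z-excl l (_ , sz) (inj₂ (_ , _ , _ , _ , _ , se)) with startsWith-head sz se
    ... | ()
    done-excl : ∀ l → Done bz bw m l → ¬ (ZFirst bz bw m l ⊎ WFirst bz bw m l ⊎ EFirst bz bw m l)
    done-excl l (_ , _ , _ , refl) (inj₁ (_ , _ , () , _))
    done-excl l (_ , _ , _ , refl) (inj₂ (inj₁ (_ , _ , _ , () , _)))
    done-excl l (_ , _ , _ , refl) (inj₂ (inj₂ (_ , _ , _ , _ , _ , _ , () , _)))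

  done-yes : Enumerates (Done false false 0) 1
  done-yes = enum-cong (λ l → mk⇔ (λ l≡[] → refl , refl , refl , l≡[]) (λ (_ , _ , _ , l≡[]) → l≡[]))
                       (enum-one [])

  done-no : ∀ {bz bw m} → (bz ≡ false → bw ≡ false → m ≡ 0 → ⊥) → Enumerates (Done bz bw m) 0
  done-no not-done = enum-none λ _ (bz≡f , bw≡f , m≡0 , _) → not-done bz≡f bw≡f m≡0

  z-yes : ∀ {bw m n} → Enumerates (Listing (Alive false bw m)) n → Enumerates (ZFirst true bw m) n
  z-yes rest = enum-cong (λ l → mk⇔ (refl ,_) proj₂) (enum-∷ z rest)

  z-no : ∀ {bw m} → Enumerates (ZFirst false bw m) 0
  z-no = enum-none λ { _ (() , _) }

  w-yes : ∀ {bz m n} → m ≤ B → Enumerates (Listing (Alive bz false m)) n →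
          Enumerates (WFirst bz true m) n
  w-yes m≤B rest = enum-cong (λ l → mk⇔ (λ s → refl , m≤B , s) (λ (_ , _ , s) → s)) (enum-∷ w rest)

  w-no : ∀ {bz bw m} → (bw ≡ true → m ≤ B → ⊥) → Enumerates (WFirst bz bw m) 0
  w-no not-w = enum-none λ _ (bw≡t , m≤B , _) → not-w bw≡t m≤B

  e-yes : ∀ {bz bw m m′ n} → m ≡ suc m′ → (bz ≡ true → A ≤ m′) → m′ < c →
          Enumerates (Listing (Alive bz bw m′)) n → Enumerates (EFirst bz bw m) n
  e-yes {bz} {bw} {m} {m′} m≡1+m′ A≤m′ m′<c rest with chainElement m′<c
  ... | k , k≡m′ = enum-cong (λ l → mk⇔ (λ s → m′ , m≡1+m′ , A≤m′ , k , k≡m′ , s) (back l))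
                             (enum-∷ (e k) rest)
    where
    -- the chain element heading the listing is determined by m
    back : ∀ l → EFirst bz bw m l → StartsWith (e k) (Listing (Alive bz bw m′)) l
    back l (m″ , m≡1+m″ , _ , j , j≡m″ , s) with suc-injective (trans (sym m≡1+m′) m≡1+m″)
    ... | refl with FinP.toℕ-injective (trans j≡m″ (sym k≡m′))
    ...   | refl = s

  e-no : ∀ {bz bw m} → (∀ m′ → m ≡ suc m′ → (bz ≡ true → A ≤ m′) → ⊥) →
         Enumerates (EFirst bz bw m) 0
  e-no not-e = enum-none λ _ (m′ , m≡1+m′ , A≤m′ , _) → not-e m′ m≡1+m′ A≤m′

  Count : Bool → Bool → ℕ → ℕ → Set
  Count bz bw m n = Enumerates (Listing (Alive bz bw m)) n

  B≤c : B ≤ c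
  B≤c = m≤m+n B q

  -- While z is alive, the chain element e_{A-1} directly above it cannot
  -- be removed when exactly A chain elements remain.
  z-blocks-e : ∀ m′ → A + 0 ≡ suc m′ → A ≤ m′ → ⊥
  z-blocks-e m′ A+0≡1+m′ A≤m′ =
    <-irrefl refl (≤-<-trans A≤m′ (subst (m′ <_) (trans (sym A+0≡1+m′) (+-identityʳ A)) (n<1+n m′)))

  -- While more than B chain elements remain, one of them is below w.
  w-blocked : ∀ i → ¬ (B + suc i ≤ B)
  w-blocked i B+1+i≤B = <-irrefl refl (<-≤-trans (m<m+n B z<s) B+1+i≤B)

  count-chain : ∀ m → m ≤ c → Count false false m 1
  count-chain zero    m≤c = enum-alive m≤c done-yes z-no (w-no λ ()) (e-no λ _ ())
  count-chain (suc m) m<c = enum-alive m<c (done-no λ _ _ ()) z-no (w-no λ ())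
                              (e-yes refl (λ ()) m<c (count-chain m (<⇒≤ m<c)))

  -- z with A + j chain elements: j + 1 places for z below the top A.
  count-z-chain : ∀ j → A + j ≤ c → Count true false (A + j) (suc j)
  count-z-chain zero    le = enum-alive le (done-no λ ()) (z-yes (count-chain (A + 0) le))
                               (w-no λ ()) (e-no λ m′ eq A≤m′ → z-blocks-e m′ eq (A≤m′ refl))
  count-z-chain (suc j) le = enum-alive le (done-no λ ()) (z-yes (count-chain (A + suc j) le))
                               (w-no λ ()) (e-yes (+-suc A j) (λ _ → m≤m+n A j)
                               (subst (_≤ c) (+-suc A j) le)
                               (count-z-chain j (≤-trans (+-monoʳ-≤ A (n≤1+n j)) le)))

  -- w with m ≤ B chain elements: all m + 1 places are allowed.
  count-w-chain : ∀ m → m ≤ B → Count false true m (suc m)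
  count-w-chain zero    _   = enum-alive z≤n (done-no λ _ ()) z-no
                                (w-yes z≤n (count-chain 0 z≤n)) (e-no λ _ ())
  count-w-chain (suc m) m<B = enum-alive (≤-trans m<B B≤c) (done-no λ _ ()) z-no
                                (w-yes m<B (count-chain (suc m) (≤-trans m<B B≤c)))
                                (e-yes refl (λ ()) (<-≤-trans m<B B≤c) (count-w-chain m (<⇒≤ m<B)))

  -- w with B + i chain elements: w must lie above the bottom i of them,
  -- leaving B + 1 places.
  count-w-chain-long : ∀ i → B + i ≤ c → Count false true (B + i) (suc B)
  count-w-chain-long zero    _  =
    subst (λ m → Count false true m (suc B)) (sym (+-identityʳ B)) (count-w-chain B ≤-refl)
  count-w-chain-long (suc i) le = enum-alive le (done-no λ _ ()) z-no (w-no λ _ → w-blocked i)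
                                    (e-yes (+-suc B i) (λ ()) (subst (_≤ c) (+-suc B i) le)
                                    (count-w-chain-long i (≤-trans (+-monoʳ-≤ B (n≤1+n i)) le)))

  count-all-short : ∀ j → j ≤ p → Count true true (A + j) (suc j * suc (A + j) + suc j)
  count-all-short zero    _   =
    subst (Count true true (A + 0)) (first A)
      (enum-alive A+0≤c (done-no λ ()) (z-yes (count-w-chain (A + 0) A+0≤B))
        (w-yes A+0≤B (count-z-chain 0 A+0≤c)) (e-no λ m′ eq A≤m′ → z-blocks-e m′ eq (A≤m′ refl)))
    where
    A+0≤B : A + 0 ≤ B
    A+0≤B = +-monoʳ-≤ A z≤n
    A+0≤c : A + 0 ≤ c
    A+0≤c = ≤-trans A+0≤B B≤c
    first : ∀ a → 0 + (suc (a + 0) + (1 + 0)) ≡ 1 * suc (a + 0) + 1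
    first = solve-∀
  count-all-short (suc j) j<p =
    subst (Count true true (A + suc j)) (next A j)
      (enum-alive A+1+j≤c (done-no λ ()) (z-yes (count-w-chain (A + suc j) A+1+j≤B))
        (w-yes A+1+j≤B (count-z-chain (suc j) A+1+j≤c))
        (e-yes (+-suc A j) (λ _ → m≤m+n A j) (subst (_≤ c) (+-suc A j) A+1+j≤c)
          (count-all-short j (<⇒≤ j<p))))
    where
    A+1+j≤B : A + suc j ≤ B
    A+1+j≤B = +-monoʳ-≤ A j<p
    A+1+j≤c : A + suc j ≤ c
    A+1+j≤c = ≤-trans A+1+j≤B B≤c
    next : ∀ a j → 0 + (suc (a + suc j) + (suc (suc j) + (suc j * suc (a + j) + suc j))) ≡
                   suc (suc j) * suc (a + suc j) + suc (suc j)
    next = solve-∀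

  count-all-long : ∀ i → B + i ≤ c → Count true true (B + i) (suc (p + i) * suc B + suc p)
  count-all-long zero    _  =
    subst₂ (Count true true) (sym (+-identityʳ B)) (cong (λ i → suc i * suc B + suc p) (sym (+-identityʳ p)))
      (count-all-short p ≤-refl)
  count-all-long (suc i) le =
    subst (Count true true (B + suc i)) (next B p i)
      (enum-alive le (done-no λ ()) (z-yes (count-w-chain-long (suc i) le)) (w-no λ _ → w-blocked i)
        (e-yes (+-suc B i) (λ _ → ≤-trans (m≤m+n A p) (m≤m+n B i)) (subst (_≤ c) (+-suc B i) le)
          (count-all-long i (≤-trans (+-monoʳ-≤ B (n≤1+n i)) le))))
    where
    next : ∀ b p i → 0 + (suc b + (0 + (suc (p + i) * suc b + suc p))) ≡ suc (p + suc i) * suc b + suc p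
    next = solve-∀

  numLinExt : NumLinExt poset (suc (p + q) * suc B + suc p)
  numLinExt = numLinExt-from-listings poset z
    (enum-cong (λ l → mk⇔ (listing-cong everything l) (listing-cong (λ y → ⇔-sym (everything y)) l))
               (count-all-long q ≤-refl))
    where
    alive : ∀ y → Alive true true c y
    alive z     = tt
    alive w     = tt
    alive (e k) = FinP.toℕ<n k
    everything : ∀ y → Alive true true c y ⇔ Whole poset y
    everything y = mk⇔ (λ _ → tt) (λ _ → alive y)

λ-resize : ∀ {n n′ k k′} → λ≤ n k → n ≡ n′ → k ≤ k′ → λ≤ n′ k′
λ-resize (P , count , size≤k) n≡n′ k≤k′ = P , subst (NumLinExt P) n≡n′ count , ≤-trans size≤k k≤k′

λ-one : λ≤ 1 0
λ-one = empty , enum-cong only-[] (enum-one []) , z≤n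
  where
  empty : FinPoset
  empty = record { size = 0 ; _≼_ = _≡_ ; isPartial = isPartialOrder }
  only-[] : ∀ v → v ≡ [] ⇔ IsLinearExtension empty v
  only-[] [] = mk⇔ (λ _ → (λ ()) , (λ ())) (λ _ → refl)

λ-gadget : ∀ A p q → λ≤ (suc (p + q) * suc (A + p) + suc p) (2 + (A + p + q))
λ-gadget A p q = Gadget.poset A p q , Gadget.numLinExt A p q , ≤-refl

-- n = Qd + R with 0 < R < d ≤ Q + 1 is realised by G(d-R, R-1, Q-R).
λ-remainder : ∀ Q d R → 0 < R → R < d → d ≤ suc Q → λ≤ (Q * d + R) (Q + d)
λ-remainder Q d (suc p) _ R<d d≤1+Q
  with k , refl ← m≤n⇒∃[o]m+o≡n R<d
  with q , refl ← m≤n⇒∃[o]m+o≡n (s≤s⁻¹ (≤-trans R<d d≤1+Q))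
  = λ-resize (λ-gadget (suc k) p q) (count p q k)
             (≤-trans (m≤m+n (2 + (suc k + p + q)) p) (≤-reflexive (elements p q k)))
  where
  count : ∀ p q k → suc (p + q) * suc (suc k + p) + suc p ≡ (suc p + q) * (suc (suc p) + k) + suc p
  count = solve-∀
  elements : ∀ p q k → 2 + (suc k + p + q) + p ≡ (suc p + q) + (suc (suc p) + k)
  elements = solve-∀

-- n = ab with 0 < b < a is realised by G(0, b-1, a-b-1).
λ-product : ∀ a b → 0 < b → b < a → λ≤ (a * b) (a + b)
λ-product a (suc p) _ b<a with q , refl ← m≤n⇒∃[o]m+o≡n b<a =
  λ-resize (λ-gadget 0 p q) (count p q)
           (≤-trans (m≤m+n (2 + (0 + p + q)) (suc p)) (≤-reflexive (elements p q)))
  where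
  count : ∀ p q → suc (p + q) * suc (0 + p) + suc p ≡ (suc (suc p) + q) * suc p
  count = solve-∀
  elements : ∀ p q → 2 + (0 + p + q) + suc p ≡ (suc (suc p) + q) + suc p
  elements = solve-∀

-- n = a² with a ≥ 2 is realised by G(a, 0, a-2).
λ-square : ∀ a → 2 ≤ a * a → λ≤ (a * a) (a + a)
λ-square 1             (s≤s ())
λ-square (suc (suc q)) _ = λ-resize (λ-gadget (suc (suc q)) 0 q) (count q) (≤-reflexive (elements q))
  where
  count : ∀ q → suc (0 + q) * suc (suc (suc q) + 0) + 1 ≡ suc (suc q) * suc (suc q)
  count = solve-∀
  elements : ∀ q → 2 + (suc (suc q) + 0 + q) ≡ suc (suc q) + suc (suc q)
  elements = solve-∀

left-factor-positive : ∀ a b → 2 ≤ a * b → 0 < a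
left-factor-positive (suc a) b _ = z<s

λ-divisible : ∀ d Q → 0 < d → d ≤ suc Q → 2 ≤ Q * d → λ≤ (Q * d) (Q + d)
λ-divisible d Q 0<d d≤1+Q 2≤n with <-cmp d Q
... | tri< d<Q _ _  = λ-product Q d 0<d d<Q
... | tri≈ _ refl _ = λ-square d 2≤n
... | tri> _ _ Q<d with ≤-antisym d≤1+Q Q<d
...   | refl = λ-resize (λ-product (suc Q) Q (left-factor-positive Q d 2≤n) ≤-refl)
                        (*-comm (suc Q) Q) (≤-reflexive (+-comm (suc Q) Q))

λ-small-divisor : ∀ d Q R → R < d → d ≤ suc Q → 2 ≤ Q * d + R → λ≤ (Q * d + R) (Q + d)
λ-small-divisor d Q (suc p) R<d d≤1+Q _   = λ-remainder Q d (suc p) z<s R<d d≤1+Q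
λ-small-divisor d Q zero    0<d d≤1+Q 2≤n =
  λ-resize (λ-divisible d Q 0<d d≤1+Q (subst (2 ≤_) (+-identityʳ (Q * d)) 2≤n))
           (sym (+-identityʳ (Q * d))) ≤-refl

-- For a divisor d + 1 > Q + 1, dividing n = Q(d+1) + R by d instead gives
-- n = Q′d + R′ with R′ < d and Q′ + d ≤ Q + (d + 1).
shrink-divisor : ∀ d Q R → R < suc d → Q < d →
                 Σ ℕ λ Q′ → Σ ℕ λ R′ → R′ < d × Q * suc d + R ≡ Q′ * d + R′ × Q′ + d ≤ Q + suc d
shrink-divisor d Q R R<1+d Q<d with Q + R <? d
... | yes Q+R<d = Q , Q + R , Q+R<d , regroup Q d R , +-monoʳ-≤ Q (n≤1+n d)
  where
  regroup : ∀ Q d R → Q * suc d + R ≡ Q * d + (Q + R)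
  regroup = solve-∀
... | no  Q+R≮d with R′ , d+R′≡Q+R ← m≤n⇒∃[o]m+o≡n (≮⇒≥ Q+R≮d) =
  suc Q , R′ , R′<d , carry , ≤-reflexive (sym (+-suc Q d))
  where
  regroup : ∀ Q d R → Q * suc d + R ≡ Q * d + (Q + R)
  regroup = solve-∀
  absorb : ∀ Q d R′ → Q * d + (d + R′) ≡ suc Q * d + R′
  absorb = solve-∀
  open ≡-Reasoning
  carry : Q * suc d + R ≡ suc Q * d + R′
  carry = begin
    Q * suc d + R     ≡⟨ regroup Q d R ⟩
    Q * d + (Q + R)   ≡⟨ cong (Q * d +_) (sym d+R′≡Q+R) ⟩
    Q * d + (d + R′)  ≡⟨ absorb Q d R′ ⟩
    suc Q * d + R′    ∎
  R′<d : R′ < d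
  R′<d = +-cancelˡ-< d R′ d (subst (_< d + d) (sym d+R′≡Q+R) (+-mono-<-≤ Q<d (s≤s⁻¹ R<1+d)))

λ-divmod : ∀ d Q R → R < d → 2 ≤ Q * d + R → λ≤ (Q * d + R) (Q + d)
λ-divmod (suc d) Q R R<d 2≤n with suc d ≤? suc Q
... | yes d≤1+Q = λ-small-divisor (suc d) Q R R<d d≤1+Q 2≤n
... | no  d≰1+Q with shrink-divisor d Q R R<d (s≤s⁻¹ (≰⇒> d≰1+Q))
...   | Q′ , R′ , R′<d , n≡ , bound =
        λ-resize (λ-divmod d Q′ R′ R′<d (subst (2 ≤_) n≡ 2≤n)) (sym n≡) bound

proposition3p1 : (n d : ℕ) → .{{_ : NonZero d}} → 1 ≤ n →
    λ≤ n ((n / d) + d)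
proposition3p1 (suc zero)      d _ = λ-resize λ-one refl z≤n
proposition3p1 n@(suc (suc _)) d _ =
  λ-resize (λ-divmod d (n / d) (n % d) (m%n<n n d) (subst (2 ≤_) division (s≤s (s≤s z≤n))))
           (sym division) ≤-refl
  where
  division : n ≡ n / d * d + n % d
  division = trans (m≡m%n+[m/n]*n n d) (+-comm (n % d) _)
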